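{- Consider the SLC problem with $m$ identical machines, $n$ jobs and a single linear constraint $\sum_{i=1}^n a_i x_i\ge b$, $\bm{x}\ge 0$, where $a_1\ge a_2\ge\cdots\ge a_n$, $b\ge 0$, and at least one $a_i>0$. Let $n'=\min\{\max\{i : a_i>0\},\, m\}$ and $\sigma=\sum_{i=1}^{n'}a_i$. Then an optimal solution is given by the processing times $x_1=\cdots=x_{n'}=b/\sigma$ and $x_i=0$ for $i>n'$, and the optimal makespan is $b/\sigma$.
   Context: The SLC problem: there are $m$ identical parallel machines and $n$ jobs. The processing times $\bm{x}=(x_1,\ldots,x_n)$ are decision variables and must satisfy given linear constraints $A\bm{x}\ge\bm{b}$, $\bm{x}\ge 0$. The goal is to choose feasible processing times and an assignment of each job to exactly one machine so as to minimize the makespan, i.e. the maximum over machines of the total processing time of the jobs assigned to that machine. Here the constraint system consists of the single inequality $\sum_i a_ix_i\ge b$ together with $\bm{x}\ge 0$.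
   Formalization: The coefficients $a_i$, the right-hand side $b$ and all processing times, including those of competing feasible solutions, are rational rather than real. -}

module Defs where

open import Data.Nat as ℕ using (ℕ; zero; suc; _⊓_)
open import Data.Fin using (Fin; zero; suc; toℕ; fromℕ; inject₁)
open import Data.Fin.Properties using (_≟_)
open import Data.Rational using (ℚ; 0ℚ; _+_; _*_; _÷_; _⊔_; _≤_; _<_; ≢-nonZero)
open import Data.Rational.Properties using (_<?_) renaming (_≟_ to _≟ℚ_)
open import Data.Product using (_×_)
open import Relation.Nullary using (yes; no)

sumFin : ∀ {n} → (Fin n → ℚ) → ℚ
sumFin {zero}  f = 0ℚ
sumFin {suc n} f = f zero + sumFin (λ i → f (suc i))

-- max_{k : Fin m} f k   (0 for m = 0; loads are nonnegative for feasible x)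
maxFin : ∀ {m} → (Fin m → ℚ) → ℚ
maxFin {zero}  f = 0ℚ
maxFin {suc m} f = f zero ⊔ maxFin (λ k → f (suc k))

load : ∀ {n m} → (Fin n → ℚ) → (Fin n → Fin m) → Fin m → ℚ
load x π k = sumFin (λ i → if-eq (π i) k (x i))
  where
  if-eq : ∀ {m} → Fin m → Fin m → ℚ → ℚ
  if-eq p q v with p ≟ q
  ... | yes _ = v
  ... | no  _ = 0ℚ

makespan : ∀ {n m} → (Fin n → ℚ) → (Fin n → Fin m) → ℚ
makespan {m = m} x π = maxFin (load x π)

Feasible : ∀ {n} → (a : Fin n → ℚ) → (b : ℚ) → (x : Fin n → ℚ) → Set
Feasible {n} a b x = ((i : Fin n) → 0ℚ ≤ x i) × (b ≤ sumFin (λ i → a i * x i))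

-- max{ i ∈ {1..n} : a_i > 0 }  (1-indexed; 0 if no a_i > 0)
lastPos : ∀ {n} → (Fin n → ℚ) → ℕ
lastPos {zero}  a = 0
lastPos {suc n} a with 0ℚ <? a (fromℕ n)
... | yes _ = suc n
... | no  _ = lastPos (λ i → a (inject₁ i))

nPrime : ∀ {n} → ℕ → (Fin n → ℚ) → ℕ
nPrime m a = lastPos a ⊓ m

-- indicator-weighted value: v if (1-indexed) index i+1 ≤ n', else 0
upTo : ∀ {n} → ℕ → Fin n → ℚ → ℚ
upTo n' i v with ℕ._<?_ (toℕ i) n'
... | yes _ = v
... | no  _ = 0ℚ

sigma : ∀ {n} → ℕ → (Fin n → ℚ) → ℚ
sigma m a = sumFin (λ i → upTo (nPrime m a) i (a i))

-- division p / q, with the (irrelevant) convention p / 0 = 0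
_/'_ : ℚ → ℚ → ℚ
p /' q with q ≟ℚ 0ℚ
... | yes _ = 0ℚ
... | no q≢0 = _÷_ p q {{≢-nonZero q≢0}}

xStar : ∀ {n} → ℕ → (Fin n → ℚ) → ℚ → Fin n → ℚ
xStar m a b i = upTo (nPrime m a) i (b /' sigma m a)

-- Write n' = min(L, m), L the last index with a_L > 0, σ = a_1 + … + a_n',
-- v = b/σ.  The schedule putting x_i = v on jobs i ≤ n' and 0 elsewhere,
-- with job i on machine i mod m, meets the constraint with equality and puts
-- at most one nonzero job on each machine, so its makespan is exactly v.
--
-- For the lower bound the schedule matters only through two facts about its
-- makespan C: every x_i ≤ C, and Σ x_i ≤ m C.  An exchange argument (lemma
-- 'exchange') shows Σ a_i x_i ≤ Σ_{i≤k} a_i C + θ (Σ x_i − k C) whenever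
-- θ separates a_1..a_k from a_{k+1}..a_n.  Taking k = L, θ = 0 when L ≤ m, and
-- k = m, θ = a_m when m < L, gives Σ a_i x_i ≤ σ C ('sigma-bound'), hence
-- b ≤ σ C and v ≤ C for every feasible x and every assignment.
module Submission where

open import Defs
open import Data.Nat using (ℕ; _≥_)
open import Data.Fin using (Fin; _≤_)
open import Data.Rational using (ℚ; 0ℚ) renaming (_≤_ to _≤ℚ_; _<_ to _<ℚ_)
open import Data.Product using (Σ; ∃; _×_)
open import Relation.Binary.PropositionalEquality using (_≡_)

open import Data.Nat as N using (zero; suc; z≤n; s≤s; z<s; s<s)
import Data.Nat.Properties as NP
open import Data.Nat.DivMod using (_mod_; m<n⇒m%n≡m)
open import Data.Fin using (toℕ; fromℕ; inject₁; fromℕ<) renaming (zero to fz; suc to fs)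
open import Data.Fin.Properties using (toℕ<n; toℕ-fromℕ; toℕ-fromℕ<; toℕ-inject₁) renaming (_≟_ to _≟F_)
open import Data.Rational using (1ℚ; _+_; _*_; -_; _-_; 1/_; positive; nonNegative; ≢-nonZero)
open import Data.Rational.Properties
  using (≤-refl; ≤-trans; ≤-antisym; <⇒≤; ≤-reflexive; <-≤-trans; <-irrefl; ≮⇒≥; _<?_; _≟_;
         +-mono-≤; +-monoˡ-≤; +-monoʳ-≤; +-identityʳ; +-identityˡ; +-inverseʳ; +-*-commutativeRing;
         *-zeroˡ; *-zeroʳ; *-identityˡ; *-comm; *-assoc; *-distribʳ-+; *-inverseʳ;
         *-monoˡ-≤-nonNeg; *-cancelˡ-≤-pos; nonNegative⁻¹; nonNeg*nonNeg⇒nonNeg;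
         p≤p⊔q; p≤q⊔p; ⊔-lub; module ≤-Reasoning)
open import Data.Product using (_,_)
open import Data.Sum using (_⊎_; inj₁; inj₂)
open import Data.Empty using (⊥-elim)
open import Function using (_∘_)
open import Relation.Nullary using (yes; no)
open import Relation.Binary.PropositionalEquality
  using (_≢_; refl; sym; trans; cong; cong₂; subst; subst₂; module ≡-Reasoning)
open import Relation.Nullary.Decidable.Core using (dec⇒maybe)
open import Tactic.RingSolver.Core.AlmostCommutativeRing using (AlmostCommutativeRing; fromCommutativeRing)
open import Level using (0ℓ)
open import Tactic.RingSolver using (solve-∀)

ℚ-ring : AlmostCommutativeRing 0ℓ 0ℓ
ℚ-ring = fromCommutativeRing +-*-commutativeRing (λ x → dec⇒maybe (0ℚ ≟ x))

≤-by-gap : ∀ {p q d} → 0ℚ ≤ℚ d → p + d ≡ q → p ≤ℚ q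
≤-by-gap {p} {q} 0≤d p+d≡q =
  ≤-trans (≤-reflexive (sym (+-identityʳ p))) (subst (p + 0ℚ ≤ℚ_) p+d≡q (+-monoʳ-≤ p 0≤d))

diff-nonneg : ∀ {p q} → p ≤ℚ q → 0ℚ ≤ℚ q - p
diff-nonneg {p} {q} p≤q = subst (_≤ℚ q - p) (+-inverseʳ p) (+-monoˡ-≤ (- p) p≤q)

diff-nonpos : ∀ {p q} → p ≤ℚ q → p - q ≤ℚ 0ℚ
diff-nonpos {p} {q} p≤q = subst (p - q ≤ℚ_) (+-inverseʳ q) (+-monoˡ-≤ (- q) p≤q)

mul-nonneg : ∀ {p q} → 0ℚ ≤ℚ p → 0ℚ ≤ℚ q → 0ℚ ≤ℚ p * q
mul-nonneg {p} {q} 0≤p 0≤q =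
  nonNegative⁻¹ _ {{nonNeg*nonNeg⇒nonNeg p {{nonNegative 0≤p}} q {{nonNegative 0≤q}}}}

div-spec : ∀ p {s} → 0ℚ <ℚ s → s * (p /' s) ≡ p
div-spec p {s} 0<s with s ≟ 0ℚ
... | yes s≡0 = ⊥-elim (<-irrefl (sym s≡0) 0<s)
... | no  s≢0 = begin
  s * (p * 1/s)    ≡⟨ cong (s *_) (*-comm p 1/s) ⟩
  s * (1/s * p)    ≡⟨ sym (*-assoc s 1/s p) ⟩
  (s * 1/s) * p    ≡⟨ cong (_* p) (*-inverseʳ s {{≢-nonZero s≢0}}) ⟩
  1ℚ * p           ≡⟨ *-identityˡ p ⟩
  p                ∎
  where
  open ≡-Reasoning
  1/s : ℚ
  1/s = (1/ s) {{≢-nonZero s≢0}}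

div-≤ : ∀ {p s C} → 0ℚ <ℚ s → p ≤ℚ s * C → p /' s ≤ℚ C
div-≤ {p} {s} 0<s p≤sC =
  *-cancelˡ-≤-pos s {{positive 0<s}} (subst (_≤ℚ s * _) (sym (div-spec p 0<s)) p≤sC)

div-nonneg : ∀ {p s} → 0ℚ <ℚ s → 0ℚ ≤ℚ p → 0ℚ ≤ℚ p /' s
div-nonneg {p} {s} 0<s 0≤p =
  *-cancelˡ-≤-pos s {{positive 0<s}}
    (subst₂ _≤ℚ_ (sym (*-zeroʳ s)) (sym (div-spec p 0<s)) 0≤p)

sum-cong : ∀ {n} {f g : Fin n → ℚ} → (∀ i → f i ≡ g i) → sumFin f ≡ sumFin g
sum-cong {zero}  f≡g = refl
sum-cong {suc n} f≡g = cong₂ _+_ (f≡g fz) (sum-cong (f≡g ∘ fs))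

sum-mono : ∀ {n} {f g : Fin n → ℚ} → (∀ i → f i ≤ℚ g i) → sumFin f ≤ℚ sumFin g
sum-mono {zero}  f≤g = ≤-refl
sum-mono {suc n} f≤g = +-mono-≤ (f≤g fz) (sum-mono (f≤g ∘ fs))

sum-zero : ∀ {n} {f : Fin n → ℚ} → (∀ i → f i ≡ 0ℚ) → sumFin f ≡ 0ℚ
sum-zero {zero}  f≡0 = refl
sum-zero {suc n} f≡0 = trans (cong₂ _+_ (f≡0 fz) (sum-zero (f≡0 ∘ fs))) (+-identityʳ 0ℚ)

sum-nonneg : ∀ {n} {f : Fin n → ℚ} → (∀ i → 0ℚ ≤ℚ f i) → 0ℚ ≤ℚ sumFin f
sum-nonneg {n} {f} 0≤f = subst (_≤ℚ sumFin f) (sum-zero {n} (λ _ → refl)) (sum-mono 0≤f)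

term-≤-sum : ∀ {n} {f : Fin n → ℚ} → (∀ i → 0ℚ ≤ℚ f i) → ∀ j → f j ≤ℚ sumFin f
term-≤-sum {suc n} 0≤f fz = ≤-by-gap (sum-nonneg (0≤f ∘ fs)) refl
term-≤-sum {suc n} {f} 0≤f (fs j) =
  ≤-trans (term-≤-sum (0≤f ∘ fs) j)
    (subst (_≤ℚ sumFin f) (+-identityˡ _) (+-monoˡ-≤ _ (0≤f fz)))

sum-+ : ∀ {n} (f g : Fin n → ℚ) → sumFin (λ i → f i + g i) ≡ sumFin f + sumFin g
sum-+ {zero}  f g = sym (+-identityʳ 0ℚ)
sum-+ {suc n} f g =
  trans (cong ((f fz + g fz) +_) (sum-+ (f ∘ fs) (g ∘ fs)))
        (interchange (f fz) (g fz) (sumFin (f ∘ fs)) (sumFin (g ∘ fs)))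
  where
  interchange : ∀ a b c d → (a + b) + (c + d) ≡ (a + c) + (b + d)
  interchange = solve-∀ ℚ-ring

sum-*ʳ : ∀ {n} (f : Fin n → ℚ) c → sumFin (λ i → f i * c) ≡ sumFin f * c
sum-*ʳ {zero}  f c = sym (*-zeroˡ c)
sum-*ʳ {suc n} f c = trans (cong (f fz * c +_) (sum-*ʳ (f ∘ fs) c)) (sym (*-distribʳ-+ c (f fz) _))

-- Linearity in the shape needed by the exchange argument.
sum-affine : ∀ {n} (f g h : Fin n → ℚ) C θ →
  sumFin (λ i → f i * C + θ * (g i - h i)) ≡ sumFin f * C + θ * (sumFin g - sumFin h)
sum-affine {zero}  f g h C θ = base C θ
  where
  base : ∀ C θ → 0ℚ ≡ 0ℚ * C + θ * (0ℚ - 0ℚ)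
  base = solve-∀ ℚ-ring
sum-affine {suc n} f g h C θ =
  trans (cong ((f fz * C + θ * (g fz - h fz)) +_) (sum-affine (f ∘ fs) (g ∘ fs) (h ∘ fs) C θ))
        (regroup (f fz) (g fz) (h fz) (sumFin (f ∘ fs)) (sumFin (g ∘ fs)) (sumFin (h ∘ fs)) C θ)
  where
  regroup : ∀ f₀ g₀ h₀ F G H C θ →
    (f₀ * C + θ * (g₀ - h₀)) + (F * C + θ * (G - H)) ≡ (f₀ + F) * C + θ * ((g₀ + G) - (h₀ + H))
  regroup = solve-∀ ℚ-ring

sum-swap : ∀ {n m} (f : Fin n → Fin m → ℚ) →
  sumFin (λ i → sumFin (f i)) ≡ sumFin (λ k → sumFin (λ i → f i k))
sum-swap {zero}  {m} f = sym (sum-zero {m} (λ _ → refl))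
sum-swap {suc n}     f =
  trans (cong (sumFin (f fz) +_) (sum-swap (f ∘ fs))) (sym (sum-+ (f fz) (λ k → sumFin (λ i → f (fs i) k))))

sum-≤-single-support : ∀ {n} (f : Fin n → ℚ) (c : ℕ) {v} → 0ℚ ≤ℚ v →
  (∀ i → f i ≤ℚ v) → (∀ i → toℕ i ≢ c → f i ≡ 0ℚ) → sumFin f ≤ℚ v
sum-≤-single-support {zero}  f c       0≤v f≤v off = 0≤v
sum-≤-single-support {suc n} f zero    0≤v f≤v off =
  subst (_≤ℚ _) (sym (trans (cong (f fz +_) (sum-zero (λ i → off (fs i) (λ ())))) (+-identityʳ (f fz))))
    (f≤v fz)
sum-≤-single-support {suc n} f (suc c) 0≤v f≤v off =
  subst (_≤ℚ _) (sym (trans (cong (_+ sumFin (f ∘ fs)) (off fz (λ ()))) (+-identityˡ _)))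
    (sum-≤-single-support (f ∘ fs) c 0≤v (f≤v ∘ fs) (λ i i≢c → off (fs i) (i≢c ∘ NP.suc-injective)))

max-ub : ∀ {m} (f : Fin m → ℚ) k → f k ≤ℚ maxFin f
max-ub f fz     = p≤p⊔q (f fz) _
max-ub f (fs k) = ≤-trans (max-ub (f ∘ fs) k) (p≤q⊔p (f fz) _)

max-lub : ∀ {m} (f : Fin m → ℚ) {v} → 0ℚ ≤ℚ v → (∀ k → f k ≤ℚ v) → maxFin f ≤ℚ v
max-lub {zero}  f 0≤v f≤v = 0≤v
max-lub {suc m} f 0≤v f≤v = ⊔-lub (f≤v fz) (max-lub (f ∘ fs) 0≤v (f≤v ∘ fs))

select : ∀ {m} → Fin m → Fin m → ℚ → ℚ
select p q v with p ≟F q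
... | yes _ = v
... | no  _ = 0ℚ

load-select : ∀ {n m} (x : Fin n → ℚ) (π : Fin n → Fin m) q →
  load x π q ≡ sumFin (λ i → select (π i) q (x i))
load-select {zero}  x π q = refl
load-select {suc n} x π q with π fz ≟F q
... | yes _ = cong (x fz +_) (load-select (x ∘ fs) (π ∘ fs) q)
... | no  _ = cong (0ℚ +_)   (load-select (x ∘ fs) (π ∘ fs) q)

select-same : ∀ {m} (p : Fin m) v → select p p v ≡ v
select-same p v with p ≟F p
... | yes _   = refl
... | no  p≢p = ⊥-elim (p≢p refl)

select-other : ∀ {m} {p q : Fin m} v → p ≢ q → select p q v ≡ 0ℚ
select-other {p = p} {q} v p≢q with p ≟F q
... | yes p≡q = ⊥-elim (p≢q p≡q)
... | no  _   = refl

select-zero : ∀ {m} (p q : Fin m) → select p q 0ℚ ≡ 0ℚ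
select-zero p q with p ≟F q
... | yes _ = refl
... | no  _ = refl

select-nonneg : ∀ {m} (p q : Fin m) {v} → 0ℚ ≤ℚ v → 0ℚ ≤ℚ select p q v
select-nonneg p q 0≤v with p ≟F q
... | yes _ = 0≤v
... | no  _ = ≤-refl

select-≤ : ∀ {m} (p q : Fin m) {v w} → 0ℚ ≤ℚ w → v ≤ℚ w → select p q v ≤ℚ w
select-≤ p q 0≤w v≤w with p ≟F q
... | yes _ = v≤w
... | no  _ = 0≤w

job-≤-makespan : ∀ {n m} {x : Fin n → ℚ} (π : Fin n → Fin m) →
  (∀ i → 0ℚ ≤ℚ x i) → ∀ i → x i ≤ℚ makespan x π
job-≤-makespan {x = x} π 0≤x i = begin
  x i                                    ≡⟨ sym (select-same (π i) (x i)) ⟩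
  select (π i) (π i) (x i)               ≤⟨ term-≤-sum (λ j → select-nonneg (π j) (π i) (0≤x j)) i ⟩
  sumFin (λ j → select (π j) (π i) (x j)) ≡⟨ sym (load-select x π (π i)) ⟩
  load x π (π i)                         ≤⟨ max-ub (load x π) (π i) ⟩
  makespan x π                           ∎
  where open ≤-Reasoning

work-≤-capacity : ∀ {n m} {x : Fin n → ℚ} (π : Fin n → Fin m) →
  (∀ i → 0ℚ ≤ℚ x i) → sumFin x ≤ℚ sumFin {m} (λ _ → makespan x π)
work-≤-capacity {m = m} {x = x} π 0≤x = begin
  sumFin x                                           ≤⟨ sum-mono own-machine ⟩
  sumFin (λ i → sumFin (λ q → select (π i) q (x i))) ≡⟨ sum-swap (λ i q → select (π i) q (x i)) ⟩
  sumFin (λ q → sumFin (λ i → select (π i) q (x i))) ≡⟨ sum-cong (sym ∘ load-select x π) ⟩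
  sumFin (load x π)                                  ≤⟨ sum-mono (max-ub (load x π)) ⟩
  sumFin {m} (λ _ → makespan x π)                    ∎
  where
  open ≤-Reasoning
  own-machine : ∀ i → x i ≤ℚ sumFin (λ q → select (π i) q (x i))
  own-machine i = subst (_≤ℚ sumFin (λ q → select (π i) q (x i))) (select-same (π i) (x i))
    (term-≤-sum (λ q → select-nonneg (π i) q (0≤x i)) (π i))

upTo-below : ∀ {n k} {i : Fin n} v → toℕ i N.< k → upTo k i v ≡ v
upTo-below {k = k} {i} v i<k with toℕ i N.<? k
... | yes _   = refl
... | no  i≮k = ⊥-elim (i≮k i<k)

upTo-above : ∀ {n k} {i : Fin n} v → k N.≤ toℕ i → upTo k i v ≡ 0ℚ
upTo-above {k = k} {i} v k≤i with toℕ i N.<? k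
... | yes i<k = ⊥-elim (NP.<⇒≱ i<k k≤i)
... | no  _   = refl

upTo-nonneg : ∀ {n} k (i : Fin n) {v} → (toℕ i N.< k → 0ℚ ≤ℚ v) → 0ℚ ≤ℚ upTo k i v
upTo-nonneg k i 0≤v with toℕ i N.<? k
... | yes i<k = 0≤v i<k
... | no  _   = ≤-refl

upTo-≤ : ∀ {n} k (i : Fin n) {v} → 0ℚ ≤ℚ v → upTo k i v ≤ℚ v
upTo-≤ k i 0≤v with toℕ i N.<? k
... | yes _ = ≤-refl
... | no  _ = 0≤v

upTo-*ˡ : ∀ {n} k (i : Fin n) p q → p * upTo k i q ≡ upTo k i p * q
upTo-*ˡ k i p q with toℕ i N.<? k
... | yes _ = refl
... | no  _ = trans (*-zeroʳ p) (sym (*-zeroˡ q))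

upTo-suc : ∀ {n} k (i : Fin n) v → upTo (suc k) (fs i) v ≡ upTo k i v
upTo-suc k i v with toℕ i N.<? k
... | yes i<k = upTo-below v (s<s i<k)
... | no  i≮k = upTo-above v (s≤s (NP.≮⇒≥ i≮k))

sum-upTo-const : ∀ {n} k c → k N.≤ n → sumFin {n} (λ i → upTo k i c) ≡ sumFin {k} (λ _ → c)
sum-upTo-const {n}     zero    c _         = sum-zero {n} (λ i → upTo-above {i = i} c z≤n)
sum-upTo-const {suc n} (suc k) c (s≤s k≤n) =
  cong₂ _+_ (upTo-below {i = fz {n}} c (z<s {k}))
    (trans (sum-cong {n} (λ i → upTo-suc k i c)) (sum-upTo-const k c k≤n))

prefixSum : ∀ {n} → ℕ → (Fin n → ℚ) → ℚ
prefixSum k a = sumFin (λ i → upTo k i (a i))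

Nonincreasing : ∀ {n} → (Fin n → ℚ) → Set
Nonincreasing {n} a = ∀ (i j : Fin n) → i ≤ j → a j ≤ℚ a i

last-or-inject : ∀ {n} (i : Fin (suc n)) → (i ≡ fromℕ n) ⊎ Σ (Fin n) (λ j → i ≡ inject₁ j)
last-or-inject {zero}  fz     = inj₁ refl
last-or-inject {suc n} fz     = inj₂ (fz , refl)
last-or-inject {suc n} (fs i) with last-or-inject i
... | inj₁ i≡last  = inj₁ (cong fs i≡last)
... | inj₂ (j , e) = inj₂ (fs j , cong fs e)

lastPos-≤ : ∀ {n} (a : Fin n → ℚ) → lastPos a N.≤ n
lastPos-≤ {zero}  a = z≤n
lastPos-≤ {suc n} a with 0ℚ <? a (fromℕ n)
... | yes _ = NP.≤-refl
... | no  _ = NP.m≤n⇒m≤1+n (lastPos-≤ (a ∘ inject₁))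

nonpos-from-lastPos : ∀ {n} (a : Fin n → ℚ) (i : Fin n) → lastPos a N.≤ toℕ i → a i ≤ℚ 0ℚ
nonpos-from-lastPos {suc n} a i L≤i with 0ℚ <? a (fromℕ n)
... | yes _    = ⊥-elim (NP.<⇒≱ (toℕ<n i) L≤i)
... | no  a≯0 with last-or-inject i
...   | inj₁ refl    = ≮⇒≥ a≯0
...   | inj₂ (j , refl) =
        nonpos-from-lastPos (a ∘ inject₁) j (subst (lastPos (a ∘ inject₁) N.≤_) (toℕ-inject₁ j) L≤i)

pos-below-lastPos : ∀ {n} (a : Fin n → ℚ) (i : Fin n) → 0ℚ <ℚ a i → toℕ i N.< lastPos a
pos-below-lastPos a i 0<aᵢ with toℕ i N.<? lastPos a
... | yes i<L = i<L
... | no  i≮L = ⊥-elim (<-irrefl refl (<-≤-trans 0<aᵢ (nonpos-from-lastPos a i (NP.≮⇒≥ i≮L))))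

lastPos-witness : ∀ {n} (a : Fin n → ℚ) →
  lastPos a ≡ 0 ⊎ Σ (Fin n) (λ j → suc (toℕ j) ≡ lastPos a × 0ℚ <ℚ a j)
lastPos-witness {zero}  a = inj₁ refl
lastPos-witness {suc n} a with 0ℚ <? a (fromℕ n)
... | yes 0<a = inj₂ (fromℕ n , cong suc (toℕ-fromℕ n) , 0<a)
... | no  _ with lastPos-witness (a ∘ inject₁)
...   | inj₁ L≡0          = inj₁ L≡0
...   | inj₂ (j , e , 0<a) = inj₂ (inject₁ j , trans (cong suc (toℕ-inject₁ j)) e , 0<a)

pos-before-lastPos : ∀ {n} {a : Fin n → ℚ} → Nonincreasing a → ∀ i → toℕ i N.< lastPos a → 0ℚ <ℚ a i
pos-before-lastPos {a = a} mono i i<L with lastPos-witness a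
... | inj₁ L≡0 = ⊥-elim (NP.<⇒≱ i<L (subst (N._≤ toℕ i) (sym L≡0) z≤n))
... | inj₂ (j , 1+j≡L , 0<aⱼ) =
  <-≤-trans 0<aⱼ (mono i j (N.s≤s⁻¹ (subst (toℕ i N.<_) (sym 1+j≡L) i<L)))

pos-before-nPrime : ∀ {n} m {a : Fin n → ℚ} → Nonincreasing a → ∀ i → toℕ i N.< nPrime m a → 0ℚ <ℚ a i
pos-before-nPrime m {a} mono i i<n' = pos-before-lastPos mono i (NP.<-≤-trans i<n' (NP.m⊓n≤m (lastPos a) m))

nPrime-pos : ∀ {n} m {a : Fin n → ℚ} → 1 N.≤ m → ∀ i → 0ℚ <ℚ a i → 1 N.≤ nPrime m a
nPrime-pos m {a} 1≤m i 0<aᵢ = NP.⊓-glb (NP.≤-<-trans z≤n (pos-below-lastPos a i 0<aᵢ)) 1≤m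

sigma-pos : ∀ {n} m {a : Fin n → ℚ} → Nonincreasing a → ∀ j → toℕ j N.< nPrime m a → 0ℚ <ℚ sigma m a
sigma-pos m {a} mono j j<n' = <-≤-trans 0<term (term-≤-sum nonneg j)
  where
  nonneg : ∀ i → 0ℚ ≤ℚ upTo (nPrime m a) i (a i)
  nonneg i = upTo-nonneg (nPrime m a) i (<⇒≤ ∘ pos-before-nPrime m mono i)
  0<term : 0ℚ <ℚ upTo (nPrime m a) j (a j)
  0<term = subst (0ℚ <ℚ_) (sym (upTo-below (a j) j<n')) (pos-before-nPrime m mono j j<n')

-- If θ is at most a_i on the first k indices and at
-- least a_i after them, and 0 ≤ x_i ≤ C, then termwise
--   a_i x_i ≤ a_i C + θ (x_i − C)   (first k, as (a_i − θ)(C − x_i) ≥ 0),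
--   a_i x_i ≤ θ x_i                 (the rest, as (θ − a_i) x_i ≥ 0),
-- and summing gives Σ a_i x_i ≤ (Σ_{first k} a_i) C + θ (Σ x_i − k C).
exchange : ∀ {n} (a x : Fin n → ℚ) k θ C →
  (∀ i → 0ℚ ≤ℚ x i) → (∀ i → x i ≤ℚ C) →
  (∀ i → toℕ i N.< k → θ ≤ℚ a i) → (∀ i → k N.≤ toℕ i → a i ≤ℚ θ) →
  sumFin (λ i → a i * x i) ≤ℚ prefixSum k a * C + θ * (sumFin x - prefixSum {n} k (λ _ → C))
exchange a x k θ C 0≤x x≤C θ≤a a≤θ =
  ≤-trans (sum-mono termwise) (≤-reflexive (sum-affine (λ i → upTo k i (a i)) x (λ i → upTo k i C) C θ))
  where
  before : ∀ a x θ C → a * x + (a - θ) * (C - x) ≡ a * C + θ * (x - C)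
  before = solve-∀ ℚ-ring
  after : ∀ a x θ C → a * x + (θ - a) * x ≡ 0ℚ * C + θ * (x - 0ℚ)
  after = solve-∀ ℚ-ring
  termwise : ∀ i → a i * x i ≤ℚ upTo k i (a i) * C + θ * (x i - upTo k i C)
  termwise i with toℕ i N.<? k
  ... | yes i<k = ≤-by-gap (mul-nonneg (diff-nonneg (θ≤a i i<k)) (diff-nonneg (x≤C i))) (before (a i) (x i) θ C)
  ... | no  i≮k = ≤-by-gap (mul-nonneg (diff-nonneg (a≤θ i (NP.≮⇒≥ i≮k))) (0≤x i)) (after (a i) (x i) θ C)

≤-drop-nonpos : ∀ {p s t} → t ≤ℚ 0ℚ → p ≤ℚ s + t → p ≤ℚ s
≤-drop-nonpos {s = s} {t} t≤0 p≤s+t = ≤-trans p≤s+t (subst (s + t ≤ℚ_) (+-identityʳ s) (+-monoʳ-≤ s t≤0))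

-- Case lastPos a ≤ m: take k = lastPos a and θ = 0.
bound-few-positive : ∀ {n} {a x : Fin n → ℚ} {C} → Nonincreasing a →
  (∀ i → 0ℚ ≤ℚ x i) → (∀ i → x i ≤ℚ C) →
  sumFin (λ i → a i * x i) ≤ℚ prefixSum (lastPos a) a * C
bound-few-positive {n} {a} {x} {C} mono 0≤x x≤C =
  ≤-drop-nonpos (≤-reflexive (*-zeroˡ (sumFin x - prefixSum {n} (lastPos a) (λ _ → C))))
    (exchange a x (lastPos a) 0ℚ C 0≤x x≤C
      (λ i i<L → <⇒≤ (pos-before-lastPos mono i i<L)) (nonpos-from-lastPos a))

-- Case m < lastPos a: take k = m and θ = a_m, and use Σ x_i ≤ m C.
bound-many-positive : ∀ {n} m₀ {a x : Fin n → ℚ} {C} → Nonincreasing a →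
  (∀ i → 0ℚ ≤ℚ x i) → (∀ i → x i ≤ℚ C) → sumFin x ≤ℚ sumFin {suc m₀} (λ _ → C) →
  suc m₀ N.< lastPos a → sumFin (λ i → a i * x i) ≤ℚ prefixSum (suc m₀) a * C
bound-many-positive {n} m₀ {a} {x} {C} mono 0≤x x≤C work≤mC m<L =
  ≤-drop-nonpos surplus≤0 (exchange a x (suc m₀) θ C 0≤x x≤C θ≤a a≤θ)
  where
  m≤n : suc m₀ N.≤ n
  m≤n = NP.<⇒≤ (NP.<-≤-trans m<L (lastPos-≤ a))
  j : Fin n
  j = fromℕ< m≤n
  θ : ℚ
  θ = a j
  θ≤a : ∀ i → toℕ i N.< suc m₀ → θ ≤ℚ a i
  θ≤a i i<m = mono i j (subst (toℕ i N.≤_) (sym (toℕ-fromℕ< m≤n)) (N.s≤s⁻¹ i<m))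
  a≤θ : ∀ i → suc m₀ N.≤ toℕ i → a i ≤ℚ θ
  a≤θ i m≤i = mono j i (subst (N._≤ toℕ i) (sym (toℕ-fromℕ< m≤n)) (NP.<⇒≤ m≤i))
  0≤θ : 0ℚ ≤ℚ θ
  0≤θ = <⇒≤ (pos-before-lastPos mono j (subst (N._< lastPos a) (sym (toℕ-fromℕ< m≤n)) (NP.<-trans (NP.n<1+n m₀) m<L)))
  mC : ℚ
  mC = prefixSum {n} (suc m₀) (λ _ → C)
  work≤mC-prefix : sumFin x ≤ℚ mC
  work≤mC-prefix = subst (sumFin x ≤ℚ_) (sym (sum-upTo-const (suc m₀) C m≤n)) work≤mC
  surplus≤0 : θ * (sumFin x - mC) ≤ℚ 0ℚ
  surplus≤0 = subst (θ * (sumFin x - mC) ≤ℚ_) (*-zeroʳ θ)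
    (*-monoˡ-≤-nonNeg θ {{nonNegative 0≤θ}} (diff-nonpos work≤mC-prefix))

sigma-bound : ∀ {n} m₀ {a x : Fin n → ℚ} {C} → Nonincreasing a →
  (∀ i → 0ℚ ≤ℚ x i) → (∀ i → x i ≤ℚ C) → sumFin x ≤ℚ sumFin {suc m₀} (λ _ → C) →
  sumFin (λ i → a i * x i) ≤ℚ sigma (suc m₀) a * C
sigma-bound m₀ {a} {x} {C} mono 0≤x x≤C work≤mC with lastPos a N.≤? suc m₀
... | yes L≤m = subst (λ k → sumFin (λ i → a i * x i) ≤ℚ prefixSum k a * C)
                  (sym (NP.m≤n⇒m⊓n≡m L≤m)) (bound-few-positive mono 0≤x x≤C)
... | no  L≰m = subst (λ k → sumFin (λ i → a i * x i) ≤ℚ prefixSum k a * C)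
                  (sym (NP.m≥n⇒m⊓n≡n (NP.<⇒≤ (NP.≰⇒> L≰m))))
                  (bound-many-positive m₀ mono 0≤x x≤C work≤mC (NP.≰⇒> L≰m))

makespan-lower-bound : ∀ {n} m₀ {a : Fin n → ℚ} {b} → Nonincreasing a → 0ℚ <ℚ sigma (suc m₀) a →
  (x : Fin n → ℚ) (π : Fin n → Fin (suc m₀)) → Feasible a b x → b /' sigma (suc m₀) a ≤ℚ makespan x π
makespan-lower-bound m₀ mono 0<σ x π (0≤x , b≤Σax) =
  div-≤ 0<σ (≤-trans b≤Σax (sigma-bound m₀ mono 0≤x (job-≤-makespan π 0≤x) (work-≤-capacity π 0≤x)))

-- The round-robin assignment: job i goes to machine i mod m, so the first m
-- jobs occupy distinct machines.
roundRobin : ∀ {n} m₀ → Fin n → Fin (suc m₀)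
roundRobin m₀ i = toℕ i mod suc m₀

toℕ-roundRobin : ∀ {n} m₀ (i : Fin n) → toℕ i N.< suc m₀ → toℕ (roundRobin m₀ i) ≡ toℕ i
toℕ-roundRobin m₀ i i<m = trans (toℕ-fromℕ< _) (m<n⇒m%n≡m i<m)

-- Processing time v on the first k ≤ m jobs, assigned round-robin, puts at
-- most one nonzero job on each machine; hence every load is at most v ...
prefix-schedule-load : ∀ {n} m₀ k {v} → k N.≤ suc m₀ → 0ℚ ≤ℚ v →
  ∀ q → load {n} (λ i → upTo k i v) (roundRobin m₀) q ≤ℚ v
prefix-schedule-load {n} m₀ k {v} k≤m 0≤v q =
  subst (_≤ℚ v) (sym (load-select y (roundRobin m₀) q))
    (sum-≤-single-support (λ i → select (roundRobin m₀ i) q (y i)) (toℕ q) 0≤v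
      (λ i → select-≤ (roundRobin m₀ i) q 0≤v (upTo-≤ k i 0≤v)) off-diagonal)
  where
  y : Fin n → ℚ
  y i = upTo k i v
  off-diagonal : ∀ i → toℕ i ≢ toℕ q → select (roundRobin m₀ i) q (upTo k i v) ≡ 0ℚ
  off-diagonal i i≢q with toℕ i N.<? k
  ... | yes i<k = select-other v (λ πi≡q →
                    i≢q (trans (sym (toℕ-roundRobin m₀ i (NP.<-≤-trans i<k k≤m))) (cong toℕ πi≡q)))
  ... | no  _   = select-zero (roundRobin m₀ i) q

prefix-schedule-makespan : ∀ {n} m₀ k {v} → k N.≤ suc m₀ → 0ℚ ≤ℚ v →
  ∀ (j : Fin n) → toℕ j N.< k → makespan (λ i → upTo k i v) (roundRobin {n} m₀) ≡ v
prefix-schedule-makespan {n} m₀ k {v} k≤m 0≤v j j<k =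
  ≤-antisym (max-lub (load y (roundRobin m₀)) 0≤v (prefix-schedule-load {n} m₀ k k≤m 0≤v))
    (subst (_≤ℚ makespan y (roundRobin m₀)) (upTo-below {i = j} v j<k)
      (job-≤-makespan (roundRobin m₀) (λ i → upTo-nonneg k i (λ _ → 0≤v)) j))
  where
  y : Fin n → ℚ
  y i = upTo k i v

xStar-feasible : ∀ {n} m (a : Fin n → ℚ) {b} → 0ℚ <ℚ sigma m a → 0ℚ ≤ℚ b → Feasible a b (xStar m a b)
xStar-feasible m a {b} 0<σ 0≤b =
  (λ i → upTo-nonneg (nPrime m a) i (λ _ → div-nonneg 0<σ 0≤b)) , ≤-reflexive (sym load-equation)
  where
  open ≡-Reasoning
  n' : ℕ
  n' = nPrime m a
  v : ℚ
  v = b /' sigma m a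
  load-equation : sumFin (λ i → a i * upTo n' i v) ≡ b
  load-equation = begin
    sumFin (λ i → a i * upTo n' i v)   ≡⟨ sum-cong (λ i → upTo-*ˡ n' i (a i) v) ⟩
    sumFin (λ i → upTo n' i (a i) * v) ≡⟨ sum-*ʳ (λ i → upTo n' i (a i)) v ⟩
    sigma m a * v                      ≡⟨ div-spec b 0<σ ⟩
    b                                  ∎

theorem2 : (m n : ℕ) → m ≥ 1 → (a : Fin n → ℚ) → (b : ℚ)
    → (∀ (i j : Fin n) → i ≤ j → a j ≤ℚ a i)
    → 0ℚ ≤ℚ b
    → ∃ (λ (i : Fin n) → 0ℚ <ℚ a i)
    → Feasible a b (xStar m a b)
      × Σ (Fin n → Fin m) (λ π → makespan (xStar m a b) π ≡ b /' sigma m a)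
      × ((x : Fin n → ℚ) → (π : Fin n → Fin m) → Feasible a b x
          → b /' sigma m a ≤ℚ makespan x π)
theorem2 (suc m₀) (suc n₀) 1≤m a b mono 0≤b (i₀ , 0<aᵢ₀) =
    xStar-feasible m a 0<σ 0≤b
  , (roundRobin m₀ , prefix-schedule-makespan m₀ n' {v} n'≤m (div-nonneg 0<σ 0≤b) fz 0<n')
  , makespan-lower-bound m₀ mono 0<σ
  where
  m n' : ℕ
  m  = suc m₀
  n' = nPrime m a
  v : ℚ
  v = b /' sigma m a
  n'≤m : n' N.≤ m
  n'≤m = NP.m⊓n≤n (lastPos a) m
  0<n' : 0 N.< n'
  0<n' = nPrime-pos m {a} 1≤m i₀ 0<aᵢ₀
  0<σ : 0ℚ <ℚ sigma m a
  0<σ = sigma-pos m mono fz 0<n'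
theorem2 (suc m₀) zero _ _ _ _ _ (() , _)
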